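{- Let $W$ be a recurrent infinite word, $S$ a Rauzy scheme for $W$, $A$ a finite factor of $W$, and $l_{\max}$ the maximal length of the words written on the edges of $S$. If $s$ is a non-extendable path in $S(A)$, then $|A|-2l_{\max}\le |F(s)|\le |A|$.
   Context: $u\sqsubseteq w$: factor; $u\sqsubseteq_k w$: at least $k$ occurrences. $W$ recurrent: every factor occurs infinitely often. A graph with words is a strongly connected directed multigraph each edge $e$ of which carries a front word $F(e)$ and a back word $B(e)$, every vertex being distributing (in-degree $1$, out-degree $>1$) or collecting (in-degree $>1$, out-degree $1$). Paths are sequences of consecutive edges with edge records (words over the edge set); for paths $s_1\sqsubseteq s_2$ means the edge record of $s_1$ is a factor of that of $s_2$. A path is symmetric if its first edge starts at a collecting vertex and its last edge ends at a distributing vertex. For $s=v_1\dots v_n$: $F(s)$ = ordered concatenation of front words of $v_1$ and all $v_i$ starting at a distributing vertex; $B(s)$ = ordered concatenation of back words of all $v_i$ ending at a collecting vertex and of $v_n$. $S$ is a Rauzy scheme for $W$ if: (1) strongly connected, more than one edge; (2) front words of edges leaving one distributing vertex have pairwise distinct first letters, back words of edges entering one collecting vertex have pairwise distinct last letters; (3) $F(s)=B(s)$ for symmetric $s$; (4) for symmetric $s_1,s_2$, $F(s_1)\sqsubseteq_kF(s_2)$ implies the edge record of $s_1$ occurs at least $k$ times in that of $s_2$; (5) edge words are factors of $W$; (6) every factor of $W$ is a factor of $F(s)$ for some symmetric $s$; (7) for every edge $e$ there is a factor $u_e$ of $W$ such that every symmetric $s$ with $u_e\sqsubseteq F(s)$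 passes through $e$. For a finite factor $A$ of $W$, $S(A)$ is the set of symmetric paths $s$ of $S$ with $F(s)\sqsubseteq A$; a non-extendable path in $S(A)$ is a maximal element of $S(A)$ with respect to $\sqsubseteq$. -}

module Defs where

open import Data.Nat using (ℕ; zero; suc; _+_; _*_; _≤_; _<_; _⊔_; _≡ᵇ_)
open import Data.Fin using (Fin; _≟_)
open import Data.List using (List; []; _∷_; _++_; length; drop; filter; allFin; concatMap; foldr; map; head; reverse)
open import Data.List.Membership.Propositional using (_∈_)
open import Data.Maybe using (Maybe)
open import Data.Bool using (Bool; if_then_else_)
open import Data.Product using (Σ; ∃; ∃₂; _×_; _,_)
open import Data.Sum using (_⊎_)
open import Data.Unit using (⊤)
open import Function.Definitions using (Injective)
open import Relation.Binary.PropositionalEquality using (_≡_; _≢_)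

_⊑_ : {X : Set} → List X → List X → Set
_⊑_ {X} u w = Σ (List X) λ p → Σ (List X) λ q → w ≡ p ++ (u ++ q)

OccAt : {X : Set} → List X → List X → ℕ → Set
OccAt {X} u w i = (i + length u ≤ length w) × Σ (List X) λ q → drop i w ≡ u ++ q

_⊑[_]_ : {X : Set} → List X → ℕ → List X → Set
u ⊑[ k ] w = Σ (Fin k → ℕ) λ f → Injective _≡_ _≡_ f × ((j : Fin k) → OccAt u w (f j))

slice : {A : Set} → (ℕ → A) → ℕ → ℕ → List A
slice W i zero = []
slice W i (suc n) = W i ∷ slice W (suc i) n

OccW : {A : Set} → List A → (ℕ → A) → ℕ → Set
OccW u W i = u ≡ slice W i (length u)

FactorW : {A : Set} → List A → (ℕ → A) → Set
FactorW u W = ∃ λ i → OccW u W i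

Recurrent : {A : Set} → (ℕ → A) → Set
Recurrent W = ∀ u → FactorW u W → ∀ N → ∃ λ i → N ≤ i × OccW u W i

module Deg (nV nE : ℕ) (src tgt : Fin nE → Fin nV) where
  indeg : Fin nV → ℕ
  indeg v = length (filter (λ e → tgt e ≟ v) (allFin nE))

  outdeg : Fin nV → ℕ
  outdeg v = length (filter (λ e → src e ≟ v) (allFin nE))

  Distributing : Fin nV → Set
  Distributing v = indeg v ≡ 1 × 1 < outdeg v

  Collecting : Fin nV → Set
  Collecting v = 1 < indeg v × outdeg v ≡ 1

  data Reach : Fin nV → Fin nV → Set where
    here : ∀ {v} → Reach v v
    step : ∀ {v w} (e : Fin nE) → src e ≡ v → Reach (tgt e) w → Reach v w

record GraphWithWords (A : Set) : Set where
  field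
    nV nE : ℕ
    src tgt : Fin nE → Fin nV
    Fw Bw : Fin nE → List A
  open Deg nV nE src tgt public
  field
    strongly-connected : ∀ v w → Reach v w
    vertex-kind : ∀ v → Distributing v ⊎ Collecting v

module _ {A : Set} (G : GraphWithWords A) where
  open GraphWithWords G

  -- Boolean tests (valid given vertex-kind: distributing iff in-degree 1,
  -- collecting iff out-degree 1)
  isDist : Fin nV → Bool
  isDist v = indeg v ≡ᵇ 1

  isColl : Fin nV → Bool
  isColl v = outdeg v ≡ᵇ 1

  Chain : Fin nE → List (Fin nE) → Set
  Chain e [] = ⊤
  Chain e (e' ∷ es) = tgt e ≡ src e' × Chain e' es

  record Path : Set where
    constructor mkPath
    field
      first : Fin nE
      rest  : List (Fin nE)
      chain : Chain first rest

  open Path public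

  edgeRecord : Path → List (Fin nE)
  edgeRecord s = first s ∷ rest s

  lastE : Fin nE → List (Fin nE) → Fin nE
  lastE e [] = e
  lastE e (e' ∷ es) = lastE e' es

  Symmetric : Path → Set
  Symmetric s = Collecting (src (first s)) × Distributing (tgt (lastE (first s) (rest s)))

  Fp : Path → List A
  Fp s = Fw (first s) ++ concatMap (λ e → if isDist (src e) then Fw e else []) (rest s)

  Bgo : Fin nE → List (Fin nE) → List A
  Bgo e [] = Bw e
  Bgo e (e' ∷ es) = (if isColl (tgt e) then Bw e else []) ++ Bgo e' es

  Bp : Path → List A
  Bp s = Bgo (first s) (rest s)

  _⊑ₚ_ : Path → Path → Set
  s₁ ⊑ₚ s₂ = edgeRecord s₁ ⊑ edgeRecord s₂

  lmax : ℕ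
  lmax = foldr _⊔_ 0 (map (λ e → length (Fw e) ⊔ length (Bw e)) (allFin nE))

  record RauzyScheme (W : ℕ → A) : Set where
    field
      -- (1) (strong connectivity is part of GraphWithWords)
      more-than-one-edge : 1 < nE
      front-first-letters : ∀ e e' → e ≢ e' → src e ≡ src e' → Distributing (src e) →
                            head (Fw e) ≢ head (Fw e')
      back-last-letters : ∀ e e' → e ≢ e' → tgt e ≡ tgt e' → Collecting (tgt e) →
                          head (reverse (Bw e)) ≢ head (Data.List.reverse (Bw e'))
      -- (3)
      F≡B : ∀ s → Symmetric s → Fp s ≡ Bp s
      -- (4)
      occurrences : ∀ s₁ s₂ → Symmetric s₁ → Symmetric s₂ → ∀ k →
                    Fp s₁ ⊑[ k ] Fp s₂ → edgeRecord s₁ ⊑[ k ] edgeRecord s₂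
      front-factor : ∀ e → FactorW (Fw e) W
      back-factor : ∀ e → FactorW (Bw e) W
      -- (6)
      covers : ∀ u → FactorW u W → Σ Path λ s → Symmetric s × u ⊑ Fp s
      edge-witness : ∀ e → Σ (List A) λ uₑ → FactorW uₑ W ×
                     (∀ s → Symmetric s → uₑ ⊑ Fp s → e ∈ edgeRecord s)

  InS : List A → Path → Set
  InS X s = Symmetric s × Fp s ⊑ X

  NonExtendable : List A → Path → Set
  NonExtendable X s = InS X s × (∀ s' → InS X s' → s ⊑ₚ s' → edgeRecord s' ≡ edgeRecord s)

-- By (6), A is a factor of F(t) for a symmetric path t.  Writing t = p s q, condition (3) gives
-- F(t) = B⁺(p) F(s) F⁺(q), where B⁺(p) collects the back words of p ending at collecting vertices and
-- F⁺(q) the front words of q starting at distributing vertices.  Front words leaving the end of a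
-- symmetric path are nonempty (otherwise (4) would embed a longer path into s), so distinct
-- occurrences of s in t give distinct occurrences of F(s) in F(t); by (4) F(s) has no further
-- occurrences, so the copy of F(s) inside A comes from a factorisation t = p s q, and
-- A = P′ F(s) Q′ with P′ a suffix of B⁺(p) and Q′ a prefix of F⁺(q).  If |Q′| > l_max, prolonging s
-- along q up to the next distributing vertex appends one front word, which fits into Q′; if
-- |P′| > l_max, prolonging s backwards to the last collecting vertex of p prepends one back word,
-- which fits into P′.  Either way s is not maximal in S(A).
module Submission where

open import Defs
open import Data.Bool using (false; if_then_else_)
open import Data.Empty using (⊥; ⊥-elim)
open import Data.Fin using (Fin; zero; suc)
import Data.Fin as F
import Data.Fin.Properties as FP
open import Data.List using (List; []; _∷_; _++_; length; concatMap; filter; upTo; lookup; take; drop; allFin; foldr; map)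
open import Data.List.Properties
  using (++-assoc; ++-identityʳ; ++-cancelˡ; ++-cancelʳ; ++-conicalˡ; ++-conicalʳ; ∷-injective; concatMap-++;
         length-++; take++drop≡id; length-take; ≡-dec)
open import Data.List.Membership.Propositional using (_∈_; find)
open import Data.List.Membership.Propositional.Properties
  using (∈-allFin; ∈-filter⁺; ∈-filter⁻; ∈-upTo⁺; ∈-upTo⁻; ∈-lookup)
open import Data.List.Relation.Unary.All as All using (All; []; _∷_)
open import Data.List.Relation.Unary.All.Properties using (¬Any⇒All¬)
open import Data.List.Relation.Unary.Any using (here; there; index; any?)
open import Data.List.Relation.Unary.Any.Properties using (lookup-index)
open import Data.List.Relation.Unary.AllPairs using (_∷_)
open import Data.List.Relation.Unary.Unique.Propositional using (Unique)
import Data.List.Relation.Unary.Unique.Propositional.Properties as Unique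
open import Data.Nat using (ℕ; zero; suc; _+_; _*_; _≤_; _<_; _⊔_; _≡ᵇ_; z≤n; s≤s)
open import Data.Nat.Properties
open import Data.Nat.Solver using (module +-*-Solver)
open import Data.Product using (Σ; _×_; _,_; proj₁; proj₂)
open import Data.Sum using (_⊎_; inj₁; inj₂)
open import Data.Unit using (⊤; tt)
open import Function.Definitions using (Injective)
open import Relation.Binary.Definitions using (tri<; tri≈; tri>)
open import Relation.Binary.PropositionalEquality
open import Relation.Nullary using (¬_; Dec; yes; no)

module _ {X : Set} where

  length-++-++ : ∀ (a b c : List X) → length (a ++ b ++ c) ≡ length a + (length b + length c)
  length-++-++ a b c = trans (length-++ a) (cong (length a +_) (length-++ b))

  length-≤-++ˡ : ∀ (a b : List X) → length b ≤ length (a ++ b)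
  length-≤-++ˡ a b = ≤-trans (m≤n+m (length b) (length a)) (≤-reflexive (sym (length-++ a)))

  length-<-++ˡ : ∀ {a : List X} (b : List X) → a ≢ [] → length b < length (a ++ b)
  length-<-++ˡ {[]}    b a≢[] = ⊥-elim (a≢[] refl)
  length-<-++ˡ {x ∷ a} b _    = s≤s (length-≤-++ˡ a b)

  length-<-++ʳ : ∀ (a : List X) {b : List X} → b ≢ [] → length a < length (a ++ b)
  length-<-++ʳ []      {[]}    b≢[] = ⊥-elim (b≢[] refl)
  length-<-++ʳ []      {x ∷ b} _    = s≤s z≤n
  length-<-++ʳ (x ∷ a) b≢[]         = s≤s (length-<-++ʳ a b≢[])

  drop-length-++ : ∀ (a b : List X) → drop (length a) (a ++ b) ≡ b
  drop-length-++ []      b = refl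
  drop-length-++ (x ∷ a) b = drop-length-++ a b

  take-length-++ : ∀ (a b : List X) → take (length a) (a ++ b) ≡ a
  take-length-++ []      b = refl
  take-length-++ (x ∷ a) b = cong (x ∷_) (take-length-++ a b)

  ++-split-≤ : ∀ (a b c d : List X) → a ++ b ≡ c ++ d → length a ≤ length c →
               Σ (List X) λ z → c ≡ a ++ z × b ≡ z ++ d
  ++-split-≤ []      b c       d eq _ = c , refl , eq
  ++-split-≤ (x ∷ a) b []      d eq ()
  ++-split-≤ (x ∷ a) b (y ∷ c) d eq (s≤s a≤c)
    with refl , eq′ ← ∷-injective eq
    with z , c≡a++z , b≡z++d ← ++-split-≤ a b c d eq′ a≤c
    = z , cong (x ∷_) c≡a++z , b≡z++d

  ++-split-≤ʳ : ∀ (a b c d : List X) → a ++ b ≡ c ++ d → length d ≤ length b →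
                Σ (List X) λ z → c ≡ a ++ z × b ≡ z ++ d
  ++-split-≤ʳ a b c d eq d≤b = ++-split-≤ a b c d eq (+-cancelʳ-≤ (length b) (length a) (length c) (begin
      length a + length b   ≡⟨ sym (length-++ a) ⟩
      length (a ++ b)       ≡⟨ cong length eq ⟩
      length (c ++ d)       ≡⟨ length-++ c ⟩
      length c + length d   ≤⟨ +-monoʳ-≤ (length c) d≤b ⟩
      length c + length b   ∎))
      where open ≤-Reasoning

  ++-split-≡ : ∀ (a b c d : List X) → a ++ b ≡ c ++ d → length a ≡ length c → a ≡ c × b ≡ d
  ++-split-≡ []      b []      d eq _ = refl , eq
  ++-split-≡ []      b (y ∷ c) d eq ()
  ++-split-≡ (x ∷ a) b []      d eq ()
  ++-split-≡ (x ∷ a) b (y ∷ c) d eq |a|≡|c|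
    with refl , eq′ ← ∷-injective eq
    with a≡c , b≡d ← ++-split-≡ a b c d eq′ (suc-injective |a|≡|c|)
    = cong (x ∷_) a≡c , b≡d

  length-<-head : ∀ (a m c a′ c′ : List X) → a ++ m ++ c ≡ a′ ++ m ++ c′ →
                  length c′ < length c → length a < length a′
  length-<-head a m c a′ c′ eq c′<c with length a <? length a′
  ... | yes a<a′ = a<a′
  ... | no  a≮a′ = ⊥-elim (<-irrefl (sym lengths) (+-mono-≤-< (≮⇒≥ a≮a′) (+-monoʳ-< (length m) c′<c)))
    where
    lengths : length a + (length m + length c) ≡ length a′ + (length m + length c′)
    lengths = trans (sym (length-++-++ a m c)) (trans (cong length eq) (length-++-++ a′ m c′))

  occAt-++ : ∀ (a u b : List X) → OccAt u (a ++ u ++ b) (length a)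
  occAt-++ a u b = bound , b , drop-length-++ a (u ++ b)
    where
    bound : length a + length u ≤ length (a ++ u ++ b)
    bound = ≤-trans (+-monoʳ-≤ (length a) (m≤m+n (length u) (length b))) (≤-reflexive (sym (length-++-++ a u b)))

  ⊑⇒length≤ : ∀ {u w : List X} → u ⊑ w → length u ≤ length w
  ⊑⇒length≤ {u} (p , q , refl) =
    ≤-trans (≤-trans (m≤m+n (length u) (length q)) (m≤n+m _ (length p))) (≤-reflexive (sym (length-++-++ p u q)))

  ≡⇒⊑[1] : ∀ {u w : List X} → u ≡ w → u ⊑[ 1 ] w
  ≡⇒⊑[1] {u} refl = (λ _ → 0) , (λ { {zero} {zero} _ → refl }) , λ _ → ≤-refl , [] , sym (++-identityʳ u)

  ⊑[1]⇒length≤ : ∀ {u w : List X} → u ⊑[ 1 ] w → length u ≤ length w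
  ⊑[1]⇒length≤ (f , _ , occ) = ≤-trans (m≤n+m _ (f zero)) (proj₁ (occ zero))

  occurrences-bounded : ∀ {u w : List X} (js : List ℕ) → (∀ {i} → OccAt u w i → i ∈ js) →
                        ¬ (u ⊑[ suc (length js) ] w)
  occurrences-bounded js all∈ (g , g-injective , occ)
    with i , j , i<j , same ← FP.pigeonhole (n<1+n (length js)) (λ k → index (all∈ (occ k)))
    = FP.<⇒≢ i<j (g-injective (begin
        g i                                   ≡⟨ lookup-index (all∈ (occ i)) ⟩
        lookup js (index (all∈ (occ i)))      ≡⟨ cong (lookup js) same ⟩
        lookup js (index (all∈ (occ j)))      ≡⟨ sym (lookup-index (all∈ (occ j))) ⟩
        g j                                   ∎))
    where open ≡-Reasoning

Unique⇒lookup-injective : ∀ {X : Set} {xs : List X} → Unique xs → ∀ i j → lookup xs i ≡ lookup xs j → i ≡ j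
Unique⇒lookup-injective (x∉ ∷ u) zero    zero    _  = refl
Unique⇒lookup-injective (x∉ ∷ u) zero    (suc j) eq = ⊥-elim (All.lookup x∉ (∈-lookup j) eq)
Unique⇒lookup-injective (x∉ ∷ u) (suc i) zero    eq = ⊥-elim (All.lookup x∉ (∈-lookup i) (sym eq))
Unique⇒lookup-injective (x∉ ∷ u) (suc i) (suc j) eq = cong suc (Unique⇒lookup-injective u i j eq)

occurrences-with-fresh : ∀ {X : Set} {u w : List X} (js : List ℕ) (pos : ℕ → ℕ) {i : ℕ} → Unique js →
  (∀ {j} → j ∈ js → OccAt u w (pos j)) →
  (∀ {j j′} → j ∈ js → j′ ∈ js → pos j ≡ pos j′ → j ≡ j′) →
  All (λ j → pos j ≢ i) js → OccAt u w i → u ⊑[ suc (length js) ] w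
occurrences-with-fresh {u = u} {w = w} js pos {i} unique occ pos-injective fresh occᵢ = f , f-injective , f-occ
  where
  f : Fin (suc (length js)) → ℕ
  f zero    = i
  f (suc k) = pos (lookup js k)

  f-injective : Injective _≡_ _≡_ f
  f-injective {zero}  {zero}   _  = refl
  f-injective {zero}  {suc k}  eq = ⊥-elim (All.lookup fresh (∈-lookup k) (sym eq))
  f-injective {suc k} {zero}   eq = ⊥-elim (All.lookup fresh (∈-lookup k) eq)
  f-injective {suc k} {suc k′} eq =
    cong suc (Unique⇒lookup-injective unique k k′ (pos-injective (∈-lookup k) (∈-lookup k′) eq))

  f-occ : ∀ k → OccAt u w (f k)
  f-occ zero    = occᵢ
  f-occ (suc k) = occ (∈-lookup k)

foldr-⊔-upper : ∀ {X : Set} (h : X → ℕ) {x : X} (l : List X) → x ∈ l → h x ≤ foldr _⊔_ 0 (map h l)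
foldr-⊔-upper h (y ∷ l) (here refl) = m≤m⊔n (h y) _
foldr-⊔-upper h (y ∷ l) (there x∈l) = ≤-trans (foldr-⊔-upper h l x∈l) (m≤n⊔m (h y) _)

module WalkFacts {A : Set} (G : GraphWithWords A) where
  open GraphWithWords G

  Edge : Set
  Edge = Fin nE

  Walk : List Edge → Set
  Walk []       = ⊤
  Walk (e ∷ es) = Chain G e es

  StartsCollecting : List Edge → Set
  StartsCollecting []      = ⊥
  StartsCollecting (e ∷ _) = Collecting (src e)

  EndsDistributing : List Edge → Set
  EndsDistributing []       = ⊥
  EndsDistributing (e ∷ es) = Distributing (tgt (lastE G e es))

  SymmetricWalk : List Edge → Set
  SymmetricWalk l = StartsCollecting l × EndsDistributing l

  LeavesNonCollecting : Edge → Set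
  LeavesNonCollecting e = ¬ Collecting (src e)

  distributing⇒¬collecting : ∀ {v} → Distributing v → ¬ Collecting v
  distributing⇒¬collecting (in≡1 , _) (1<in , _) = <-irrefl (sym in≡1) 1<in

  ¬collecting⇒distributing : ∀ {v} → ¬ Collecting v → Distributing v
  ¬collecting⇒distributing {v} ¬c with vertex-kind v
  ... | inj₁ d = d
  ... | inj₂ c = ⊥-elim (¬c c)

  private
    >1⇒≡ᵇ1-false : ∀ {n} → 1 < n → (n ≡ᵇ 1) ≡ false
    >1⇒≡ᵇ1-false {suc zero}    (s≤s ())
    >1⇒≡ᵇ1-false {suc (suc n)} _ = refl

  -- On the edge record e ∷ es of a path, frontWord and backWord are Fp and Bp definitionally;
  -- fronts and backs collect the words that the edges after the first (before the last) contribute.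
  front : Edge → List A
  front e = if isDist G (src e) then Fw e else []

  back : Edge → List A
  back e = if isColl G (tgt e) then Bw e else []

  fronts backs : List Edge → List A
  fronts = concatMap front
  backs  = concatMap back

  frontWord : List Edge → List A
  frontWord []       = []
  frontWord (e ∷ es) = Fw e ++ fronts es

  backWord : List Edge → List A
  backWord []       = []
  backWord (e ∷ es) = Bgo G e es

  front-distributing : ∀ {e} → Distributing (src e) → front e ≡ Fw e
  front-distributing {e} (in≡1 , _) = cong (λ b → if b then Fw e else []) (cong (_≡ᵇ 1) in≡1)

  front-collecting : ∀ {e} → Collecting (src e) → front e ≡ []
  front-collecting {e} (1<in , _) = cong (λ b → if b then Fw e else []) (>1⇒≡ᵇ1-false 1<in)

  back-collecting : ∀ {e} → Collecting (tgt e) → back e ≡ Bw e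
  back-collecting {e} (_ , out≡1) = cong (λ b → if b then Bw e else []) (cong (_≡ᵇ 1) out≡1)

  back-distributing : ∀ {e} → Distributing (tgt e) → back e ≡ []
  back-distributing {e} (_ , 1<out) = cong (λ b → if b then Bw e else []) (>1⇒≡ᵇ1-false 1<out)

  wordLength : Edge → ℕ
  wordLength e = length (Fw e) ⊔ length (Bw e)

  wordLength≤lmax : ∀ e → wordLength e ≤ lmax G
  wordLength≤lmax e = foldr-⊔-upper wordLength (allFin nE) (∈-allFin e)

  Fw-length≤lmax : ∀ e → length (Fw e) ≤ lmax G
  Fw-length≤lmax e = ≤-trans (m≤m⊔n _ _) (wordLength≤lmax e)

  Bw-length≤lmax : ∀ e → length (Bw e) ≤ lmax G
  Bw-length≤lmax e = ≤-trans (m≤n⊔m _ _) (wordLength≤lmax e)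

  walk-++ˡ : ∀ l m → Walk (l ++ m) → Walk l
  walk-++ˡ []          m _       = tt
  walk-++ˡ (x ∷ [])    m _       = tt
  walk-++ˡ (x ∷ y ∷ l) m (e , w) = e , walk-++ˡ (y ∷ l) m w

  walk-++ʳ : ∀ l m → Walk (l ++ m) → Walk m
  walk-++ʳ []          m       w       = w
  walk-++ʳ (x ∷ [])    []      _       = tt
  walk-++ʳ (x ∷ [])    (y ∷ m) (_ , w) = w
  walk-++ʳ (x ∷ y ∷ l) m       (_ , w) = walk-++ʳ (y ∷ l) m w

  walk-++-++ˡ : ∀ p l q → Walk (p ++ l ++ q) → Walk (p ++ l)
  walk-++-++ˡ p l q w = walk-++ˡ (p ++ l) q (subst Walk (sym (++-assoc p l q)) w)

  walk-junction : ∀ x l y m → Walk (x ∷ l ++ y ∷ m) → tgt (lastE G x l) ≡ src y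
  walk-junction x []      y m (e , _) = e
  walk-junction x (z ∷ l) y m (_ , w) = walk-junction z l y m w

  lastE-++ : ∀ x l y m → lastE G x (l ++ y ∷ m) ≡ lastE G y m
  lastE-++ x []      y m = refl
  lastE-++ x (z ∷ l) y m = lastE-++ z l y m

  endsDistributing-++⁺ : ∀ l m → EndsDistributing m → EndsDistributing (l ++ m)
  endsDistributing-++⁺ []      m       d = d
  endsDistributing-++⁺ (x ∷ l) (y ∷ m) d = subst (λ e → Distributing (tgt e)) (sym (lastE-++ x l y m)) d

  endsDistributing-++⁻ : ∀ l y m → EndsDistributing (l ++ y ∷ m) → EndsDistributing (y ∷ m)
  endsDistributing-++⁻ []      y m d = d
  endsDistributing-++⁻ (x ∷ l) y m d = subst (λ e → Distributing (tgt e)) (lastE-++ x l y m) d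

  startsCollecting-++ : ∀ p l m → StartsCollecting l → StartsCollecting (p ++ l ++ m) → StartsCollecting (p ++ l)
  startsCollecting-++ []      l m c _ = c
  startsCollecting-++ (x ∷ p) l m _ c = c

  frontWord-∷-++ : ∀ x l m → frontWord (x ∷ l ++ m) ≡ frontWord (x ∷ l) ++ fronts m
  frontWord-∷-++ x l m = trans (cong (Fw x ++_) (concatMap-++ front l m)) (sym (++-assoc (Fw x) (fronts l) (fronts m)))

  frontWord-++ : ∀ p s ss q → frontWord (p ++ (s ∷ ss) ++ q) ≡ frontWord (p ++ s ∷ ss) ++ fronts q
  frontWord-++ []      s ss q = frontWord-∷-++ s ss q
  frontWord-++ (x ∷ p) s ss q =
    trans (cong (λ l → frontWord (x ∷ l)) (sym (++-assoc p (s ∷ ss) q))) (frontWord-∷-++ x (p ++ s ∷ ss) q)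

  backWord-++ : ∀ l e es → backWord (l ++ e ∷ es) ≡ backs l ++ backWord (e ∷ es)
  backWord-++ []      e es = refl
  backWord-++ (x ∷ l) e es = Bgo-++ x l
    where
    Bgo-++ : ∀ x l → Bgo G x (l ++ e ∷ es) ≡ backs (x ∷ l) ++ Bgo G e es
    Bgo-++ x []      = cong (_++ Bgo G e es) (sym (++-identityʳ (back x)))
    Bgo-++ x (y ∷ l) = trans (cong (back x ++_) (Bgo-++ y l)) (sym (++-assoc (back x) (backs (y ∷ l)) (Bgo G e es)))

  nextDistributing : ∀ e r → Walk (e ∷ r) → EndsDistributing (e ∷ r) →
    Σ (List Edge) λ r₁ → Σ (List Edge) λ r₂ →
      r ≡ r₁ ++ r₂ × Distributing (tgt (lastE G e r₁)) × fronts r₁ ≡ []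
  nextDistributing e []      _          d = [] , [] , refl , d , refl
  nextDistributing e (x ∷ r) (e→x , w) d with vertex-kind (tgt e)
  ... | inj₁ dist = [] , x ∷ r , refl , dist , refl
  ... | inj₂ coll
    with r₁ , r₂ , r≡ , dist , none ← nextDistributing x r w d
    = x ∷ r₁ , r₂ , cong (x ∷_) r≡ , dist , cong₂ _++_ (front-collecting (subst Collecting e→x coll)) none

  lastCollecting : ∀ l → All LeavesNonCollecting l ⊎
    Σ (List Edge) λ p → Σ Edge λ b → Σ (List Edge) λ bs →
      l ≡ p ++ b ∷ bs × Collecting (src b) × All LeavesNonCollecting bs
  lastCollecting [] = inj₁ []
  lastCollecting (x ∷ l) with lastCollecting l
  ... | inj₂ (p , b , bs , l≡ , c , none) = inj₂ (x ∷ p , b , bs , cong (x ∷_) l≡ , c , none)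
  ... | inj₁ none with vertex-kind (src x)
  ...   | inj₁ d = inj₁ (distributing⇒¬collecting d ∷ none)
  ...   | inj₂ c = inj₂ ([] , x , l , refl , c , none)

  backs-until-collecting : ∀ b bs x xs → Walk (b ∷ bs ++ x ∷ xs) → Collecting (src x) →
                           All LeavesNonCollecting bs → backs (b ∷ bs) ≡ Bw (lastE G b bs)
  backs-until-collecting b []       x xs (b→x , _) cx [] =
    trans (++-identityʳ (back b)) (back-collecting (subst Collecting (sym b→x) cx))
  backs-until-collecting b (y ∷ bs) x xs (b→y , w) cx (ny ∷ none) =
    trans (cong (_++ backs (y ∷ bs)) (back-distributing (subst Distributing (sym b→y) (¬collecting⇒distributing ny))))
          (backs-until-collecting y bs x xs w cx none)

  extendRight : ∀ s ss e r → Walk (s ∷ ss ++ e ∷ r) → SymmetricWalk (s ∷ ss) → EndsDistributing (e ∷ r) →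
    Distributing (src e) ×
    Σ (List Edge) λ r₁ → Walk (s ∷ ss ++ e ∷ r₁) × SymmetricWalk (s ∷ ss ++ e ∷ r₁) ×
                         frontWord (s ∷ ss ++ e ∷ r₁) ≡ frontWord (s ∷ ss) ++ Fw e
  extendRight s ss e r w (cS , dS) d
    with r₁ , r₂ , refl , d₁ , none ← nextDistributing e r (walk-++ʳ (s ∷ ss) (e ∷ r) w) d
    = dE , r₁ , w′ , (cS , endsDistributing-++⁺ (s ∷ ss) (e ∷ r₁) d₁) , F′
    where
    dE : Distributing (src e)
    dE = subst Distributing (walk-junction s ss e (r₁ ++ r₂) w) dS
    w′ : Walk (s ∷ ss ++ e ∷ r₁)
    w′ = walk-++ˡ (s ∷ ss ++ e ∷ r₁) r₂ (subst (λ l → Walk (s ∷ l)) (sym (++-assoc ss (e ∷ r₁) r₂)) w)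
    F′ : frontWord (s ∷ ss ++ e ∷ r₁) ≡ frontWord (s ∷ ss) ++ Fw e
    F′ = trans (frontWord-∷-++ s ss (e ∷ r₁))
               (cong (frontWord (s ∷ ss) ++_) (trans (cong₂ _++_ (front-distributing dE) none) (++-identityʳ (Fw e))))

module SchemeFacts {A : Set} {W : ℕ → A} (G : GraphWithWords A) (RS : RauzyScheme G W) where
  open GraphWithWords G
  open RauzyScheme RS
  open WalkFacts G

  frontWord≡backWord : ∀ l → Walk l → SymmetricWalk l → frontWord l ≡ backWord l
  frontWord≡backWord (x ∷ xs) w sy = F≡B (mkPath x xs w) sy

  occurrences-walk : ∀ l₁ l₂ → Walk l₁ → SymmetricWalk l₁ → Walk l₂ → SymmetricWalk l₂ →
                     ∀ k → frontWord l₁ ⊑[ k ] frontWord l₂ → l₁ ⊑[ k ] l₂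
  occurrences-walk (x ∷ xs) (y ∷ ys) w₁ sy₁ w₂ sy₂ =
    occurrences (mkPath x xs w₁) (mkPath y ys w₂) sy₁ sy₂

  frontWord-prepend : ∀ p s ss → Walk (p ++ s ∷ ss) → StartsCollecting (p ++ s ∷ ss) →
                      SymmetricWalk (s ∷ ss) → frontWord (p ++ s ∷ ss) ≡ backs p ++ frontWord (s ∷ ss)
  frontWord-prepend p s ss w c sy@(_ , dS) = begin
    frontWord (p ++ S)      ≡⟨ frontWord≡backWord (p ++ S) w (c , endsDistributing-++⁺ p S dS) ⟩
    backWord (p ++ S)       ≡⟨ backWord-++ p s ss ⟩
    backs p ++ backWord S   ≡⟨ cong (backs p ++_) (sym (frontWord≡backWord S (walk-++ʳ p S w) sy)) ⟩
    backs p ++ frontWord S  ∎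
    where
    open ≡-Reasoning
    S : List Edge
    S = s ∷ ss

  frontWord-infix : ∀ {T} p s ss q → T ≡ p ++ (s ∷ ss) ++ q → Walk T → StartsCollecting T →
                    SymmetricWalk (s ∷ ss) → frontWord T ≡ backs p ++ frontWord (s ∷ ss) ++ fronts q
  frontWord-infix p s ss q refl w c sy@(cS , _) = begin
    frontWord (p ++ (s ∷ ss) ++ q)               ≡⟨ frontWord-++ p s ss q ⟩
    frontWord (p ++ s ∷ ss) ++ fronts q           ≡⟨ cong (_++ fronts q) F-prefix ⟩
    (backs p ++ frontWord (s ∷ ss)) ++ fronts q   ≡⟨ ++-assoc (backs p) _ _ ⟩
    backs p ++ frontWord (s ∷ ss) ++ fronts q     ∎
    where
    open ≡-Reasoning
    F-prefix : frontWord (p ++ s ∷ ss) ≡ backs p ++ frontWord (s ∷ ss)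
    F-prefix = frontWord-prepend p s ss (walk-++-++ˡ p (s ∷ ss) q w) (startsCollecting-++ p (s ∷ ss) q cS c) sy

  extendLeft : ∀ p s ss → Walk (p ++ s ∷ ss) → StartsCollecting p → SymmetricWalk (s ∷ ss) →
    Σ (List Edge) λ p₁ → Σ Edge λ b → Σ (List Edge) λ bs →
      Walk (b ∷ bs ++ s ∷ ss) × SymmetricWalk (b ∷ bs ++ s ∷ ss) ×
      backs p ≡ backs p₁ ++ Bw (lastE G b bs) ×
      frontWord (b ∷ bs ++ s ∷ ss) ≡ Bw (lastE G b bs) ++ frontWord (s ∷ ss)
  extendLeft p s ss w c sy@(cS , dS) with lastCollecting p
  ... | inj₁ none = ⊥-elim (noneStartsCollecting p none c)
    where
    noneStartsCollecting : ∀ l → All LeavesNonCollecting l → ¬ StartsCollecting l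
    noneStartsCollecting (x ∷ l) (¬c ∷ _) = ¬c
  ... | inj₂ (p₁ , b , bs , refl , cb , none) =
    p₁ , b , bs , w′ , sy′ ,
    trans (concatMap-++ back p₁ (b ∷ bs)) (cong (backs p₁ ++_) backs-b≡) ,
    trans (frontWord-prepend (b ∷ bs) s ss w′ cb sy) (cong (_++ frontWord (s ∷ ss)) backs-b≡)
    where
    w′ : Walk (b ∷ bs ++ s ∷ ss)
    w′ = walk-++ʳ p₁ (b ∷ bs ++ s ∷ ss) (subst Walk (++-assoc p₁ (b ∷ bs) (s ∷ ss)) w)
    sy′ : SymmetricWalk (b ∷ bs ++ s ∷ ss)
    sy′ = cb , endsDistributing-++⁺ (b ∷ bs) (s ∷ ss) dS
    backs-b≡ : backs (b ∷ bs) ≡ Bw (lastE G b bs)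
    backs-b≡ = backs-until-collecting b bs s ss w′ cS none

  -- Otherwise prolonging s ∷ ss up to the next distributing vertex leaves F unchanged, and (4) with k = 1
  -- would embed the longer path into s ∷ ss.
  Fw-nonempty : ∀ s ss e r → Walk (s ∷ ss ++ e ∷ r) → SymmetricWalk (s ∷ ss) → EndsDistributing (e ∷ r) →
                Fw e ≢ []
  Fw-nonempty s ss e r w sy d Fw≡[]
    with _ , r₁ , w′ , sy′ , F′ ← extendRight s ss e r w sy d
    = <⇒≱ (length-<-++ʳ (s ∷ ss) {e ∷ r₁} (λ ()))
          (⊑[1]⇒length≤ (occurrences-walk (s ∷ ss ++ e ∷ r₁) (s ∷ ss) w′ sy′ (walk-++ˡ (s ∷ ss) (e ∷ r) w) sy
                                           1 (≡⇒⊑[1] F′≡F)))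
    where
    F′≡F : frontWord (s ∷ ss ++ e ∷ r₁) ≡ frontWord (s ∷ ss)
    F′≡F = trans F′ (trans (cong (frontWord (s ∷ ss) ++_) Fw≡[]) (++-identityʳ _))

  fronts-<-∷-++ : ∀ s ss e z r → Walk (s ∷ ss ++ e ∷ z ++ r) → SymmetricWalk (s ∷ ss) →
                  EndsDistributing (e ∷ z ++ r) → length (fronts r) < length (fronts (e ∷ z ++ r))
  fronts-<-∷-++ s ss e z r w sy d = begin-strict
    length (fronts r)                      ≤⟨ length-≤-++ˡ (fronts z) (fronts r) ⟩
    length (fronts z ++ fronts r)          <⟨ length-<-++ˡ (fronts z ++ fronts r) (Fw-nonempty s ss e (z ++ r) w sy d) ⟩
    length (Fw e ++ fronts z ++ fronts r)  ≡⟨ cong length (sym fronts≡) ⟩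
    length (fronts (e ∷ z ++ r))           ∎
    where
    open ≤-Reasoning
    fronts≡ : fronts (e ∷ z ++ r) ≡ Fw e ++ fronts z ++ fronts r
    fronts≡ = cong₂ _++_ (front-distributing (subst Distributing (walk-junction s ss e (z ++ r) w) (proj₂ sy)))
                         (concatMap-++ front z r)

  backs-<-mono : ∀ p p′ s ss q q′ → p ++ (s ∷ ss) ++ q ≡ p′ ++ (s ∷ ss) ++ q′ →
                 Walk (p ++ (s ∷ ss) ++ q) → SymmetricWalk (p ++ (s ∷ ss) ++ q) → SymmetricWalk (s ∷ ss) →
                 length p < length p′ → length (backs p) < length (backs p′)
  backs-<-mono p p′ s ss q q′ eq w syT sy p<p′
    with ++-split-≤ (p ++ S) q (p′ ++ S) q′ (trans (++-assoc p S q) (trans eq (sym (++-assoc p′ S q′)))) pS≤p′S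
    where
    S : List Edge
    S = s ∷ ss
    pS≤p′S : length (p ++ S) ≤ length (p′ ++ S)
    pS≤p′S = begin
      length (p ++ S)       ≡⟨ length-++ p ⟩
      length p + length S   ≤⟨ +-monoˡ-≤ (length S) (<⇒≤ p<p′) ⟩
      length p′ + length S  ≡⟨ sym (length-++ p′) ⟩
      length (p′ ++ S)      ∎
      where open ≤-Reasoning
  ... | [] , p′S≡pS , _ =
    ⊥-elim (<-irrefl (cong length (sym (++-cancelʳ (s ∷ ss) p′ p (trans p′S≡pS (++-identityʳ _))))) p<p′)
  ... | e ∷ z , _ , refl =
    length-<-head (backs p) (frontWord (s ∷ ss)) (fronts (e ∷ z ++ q′)) (backs p′) (fronts q′) F-twice
      (fronts-<-∷-++ s ss e z q′ (walk-++ʳ p _ w) sy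
        (endsDistributing-++⁻ (s ∷ ss) e (z ++ q′) (endsDistributing-++⁻ p s (ss ++ e ∷ z ++ q′) (proj₂ syT))))
    where
    open ≡-Reasoning
    F-twice : backs p ++ frontWord (s ∷ ss) ++ fronts (e ∷ z ++ q′) ≡ backs p′ ++ frontWord (s ∷ ss) ++ fronts q′
    F-twice = begin
      backs p ++ frontWord (s ∷ ss) ++ fronts (e ∷ z ++ q′)  ≡⟨ sym (frontWord-infix p s ss _ refl w (proj₁ syT) sy) ⟩
      frontWord (p ++ (s ∷ ss) ++ e ∷ z ++ q′)               ≡⟨ frontWord-infix p′ s ss q′ eq w (proj₁ syT) sy ⟩
      backs p′ ++ frontWord (s ∷ ss) ++ fronts q′            ∎

  -- Occurrences of S in T are enumerated by their starting indices j; position j is where the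
  -- corresponding copy of F(S) starts in F(T).
  module Alignment (s : Edge) (ss : List Edge) (T : List Edge)
                   (wS : Walk (s ∷ ss)) (symS : SymmetricWalk (s ∷ ss)) (wT : Walk T) (symT : SymmetricWalk T) where
    S : List Edge
    S = s ∷ ss

    startsAt? : ∀ j → Dec (take (length S) (drop j T) ≡ S)
    startsAt? j = ≡-dec F._≟_ (take (length S) (drop j T)) S

    starts : List ℕ
    starts = filter startsAt? (upTo (length T))

    position : ℕ → ℕ
    position j = length (backs (take j T))

    after : ℕ → List Edge
    after j = drop (length S) (drop j T)

    ∈starts⁻ : ∀ {j} → j ∈ starts → j < length T × take (length S) (drop j T) ≡ S
    ∈starts⁻ j∈ with j∈upTo , S≡ ← ∈-filter⁻ startsAt? j∈ = ∈-upTo⁻ j∈upTo , S≡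

    occAt⇒∈starts : ∀ {i} → OccAt S T i → i ∈ starts
    occAt⇒∈starts {i} (bound , q , T≡) = ∈-filter⁺ startsAt? (∈-upTo⁺ i<|T|) S-at-i
      where
      i<|T| : i < length T
      i<|T| = <-≤-trans (m<m+n i (s≤s z≤n)) bound
      S-at-i : take (length S) (drop i T) ≡ S
      S-at-i = subst (λ l → take (length S) l ≡ S) (sym T≡) (take-length-++ S q)

    factorAt : ∀ {j} → j ∈ starts → T ≡ take j T ++ S ++ after j
    factorAt {j} j∈ = begin
      T                                                ≡⟨ sym (take++drop≡id j T) ⟩
      take j T ++ drop j T                             ≡⟨ cong (take j T ++_) (sym (take++drop≡id (length S) (drop j T))) ⟩
      take j T ++ take (length S) (drop j T) ++ after j ≡⟨ cong (λ l → take j T ++ l ++ after j) (proj₂ (∈starts⁻ j∈)) ⟩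
      take j T ++ S ++ after j                         ∎
      where open ≡-Reasoning

    position-occurrence : ∀ {j} → j ∈ starts → OccAt (frontWord S) (frontWord T) (position j)
    position-occurrence {j} j∈ =
      subst (λ l → OccAt (frontWord S) l (position j)) (sym FT≡) (occAt-++ (backs (take j T)) (frontWord S) (fronts (after j)))
      where
      FT≡ : frontWord T ≡ backs (take j T) ++ frontWord S ++ fronts (after j)
      FT≡ = frontWord-infix (take j T) s ss (after j) (factorAt j∈) wT (proj₁ symT) symS

    position-<-mono : ∀ {j j′} → j ∈ starts → j′ ∈ starts → j < j′ → position j < position j′
    position-<-mono {j} {j′} j∈ j′∈ j<j′ =
      backs-<-mono (take j T) (take j′ T) s ss _ _ (trans (sym (factorAt j∈)) (factorAt j′∈))
        (subst Walk (factorAt j∈) wT) (subst SymmetricWalk (factorAt j∈) symT) symS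
        (subst₂ _<_ (sym (length-take-start j∈)) (sym (length-take-start j′∈)) j<j′)
      where
      length-take-start : ∀ {j} → j ∈ starts → length (take j T) ≡ j
      length-take-start {j} j∈ = trans (length-take j T) (m≤n⇒m⊓n≡m (<⇒≤ (proj₁ (∈starts⁻ j∈))))

    position-injective : ∀ {j j′} → j ∈ starts → j′ ∈ starts → position j ≡ position j′ → j ≡ j′
    position-injective {j} {j′} j∈ j′∈ eq with <-cmp j j′
    ... | tri< j<j′ _ _ = ⊥-elim (<-irrefl eq (position-<-mono j∈ j′∈ j<j′))
    ... | tri≈ _ j≡j′ _ = j≡j′
    ... | tri> _ _ j′<j = ⊥-elim (<-irrefl (sym eq) (position-<-mono j′∈ j∈ j′<j))

    -- A copy of F(S) at a position not of the form position j would give F(S) more occurrences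
    -- in F(T) than S has in T, against (4).
    align : ∀ {i} → OccAt (frontWord S) (frontWord T) i →
            Σ (List Edge) λ p → Σ (List Edge) λ q → T ≡ p ++ S ++ q × length (backs p) ≡ i
    align {i} occ with any? (λ j → position j ≟ i) starts
    ... | yes found with j , j∈ , position≡i ← find found = take j T , _ , factorAt j∈ , position≡i
    align {i} occ | no none =
      ⊥-elim (occurrences-bounded starts occAt⇒∈starts (occurrences-walk S T wS symS wT symT _
        (occurrences-with-fresh starts position (Unique.filter⁺ startsAt? (Unique.upTo⁺ (length T)))
           position-occurrence position-injective (¬Any⇒All¬ starts none) occ)))

  module Margins (X : List A) (s : Edge) (ss : List Edge) (wS : Walk (s ∷ ss)) (symS : SymmetricWalk (s ∷ ss))
                 (maximal : ∀ x xs (w : Chain G x xs) → SymmetricWalk (x ∷ xs) → frontWord (x ∷ xs) ⊑ X →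
                            (s ∷ ss) ⊑ (x ∷ xs) → x ∷ xs ≡ s ∷ ss)
                 (P′ Q′ : List A) (X≡ : X ≡ P′ ++ frontWord (s ∷ ss) ++ Q′) where
    S : List Edge
    S = s ∷ ss

    noLongerPath : ∀ x xs (w : Chain G x xs) → SymmetricWalk (x ∷ xs) → frontWord (x ∷ xs) ⊑ X →
                   S ⊑ (x ∷ xs) → ¬ (length S < length (x ∷ xs))
    noLongerPath x xs w sy F⊑X S⊑ longer = <⇒≢ longer (sym (cong length (maximal x xs w sy F⊑X S⊑)))

    noRoomRight : ∀ p q → Walk (p ++ S ++ q) → EndsDistributing (p ++ S ++ q) → ∀ {Q} →
                  fronts q ≡ Q′ ++ Q → ¬ (lmax G < length Q′)
    noRoomRight p []      _ _ {Q} fronts≡ lt =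
      n≮0 (subst (λ l → lmax G < length l) (++-conicalˡ Q′ Q (sym fronts≡)) lt)
    noRoomRight p (e ∷ r) w d {Q} fronts≡ lt
      with dE , r₁ , w′ , sy′ , F′ ← extendRight s ss e r (walk-++ʳ p (S ++ e ∷ r) w) symS
                                       (endsDistributing-++⁻ S e r (endsDistributing-++⁻ p s (ss ++ e ∷ r) d))
      with z , Q′≡ , _ ← ++-split-≤ (Fw e) (fronts r) Q′ Q
                            (trans (cong (_++ fronts r) (sym (front-distributing dE))) fronts≡)
                            (≤-trans (Fw-length≤lmax e) (<⇒≤ lt))
      = noLongerPath s (ss ++ e ∷ r₁) w′ sy′ (P′ , z , X≡′) ([] , e ∷ r₁ , refl)
                     (length-<-++ʳ S {e ∷ r₁} (λ ()))
      where
      open ≡-Reasoning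
      X≡′ : X ≡ P′ ++ frontWord (S ++ e ∷ r₁) ++ z
      X≡′ = begin
        X                                   ≡⟨ X≡ ⟩
        P′ ++ frontWord S ++ Q′             ≡⟨ cong (λ l → P′ ++ frontWord S ++ l) Q′≡ ⟩
        P′ ++ frontWord S ++ Fw e ++ z      ≡⟨ cong (P′ ++_) (sym (++-assoc (frontWord S) (Fw e) z)) ⟩
        P′ ++ (frontWord S ++ Fw e) ++ z    ≡⟨ cong (λ l → P′ ++ l ++ z) (sym F′) ⟩
        P′ ++ frontWord (S ++ e ∷ r₁) ++ z  ∎

    noRoomLeft : ∀ p q → Walk (p ++ S ++ q) → StartsCollecting (p ++ S ++ q) → ∀ {P} →
                 backs p ≡ P ++ P′ → ¬ (lmax G < length P′)
    noRoomLeft []       _ _ _ {P} backs≡ lt =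
      n≮0 (subst (λ l → lmax G < length l) (++-conicalʳ P P′ (sym backs≡)) lt)
    noRoomLeft (a ∷ as) q w c {P} backs≡ lt
      with p₁ , b , bs , w′ , sy′ , backs-p≡ , F′ ←
             extendLeft (a ∷ as) s ss (walk-++-++ˡ (a ∷ as) S q w) c symS
      with z , _ , P′≡ ← ++-split-≤ʳ P P′ (backs p₁) (Bw (lastE G b bs)) (trans (sym backs≡) backs-p≡)
                           (≤-trans (Bw-length≤lmax (lastE G b bs)) (<⇒≤ lt))
      = noLongerPath b (bs ++ S) w′ sy′ (z , Q′ , X≡′) (b ∷ bs , [] , S-inside)
                     (length-<-++ˡ {a = b ∷ bs} S (λ ()))
      where
      S-inside : b ∷ bs ++ S ≡ b ∷ bs ++ S ++ []
      S-inside = cong (λ l → b ∷ bs ++ l) (sym (++-identityʳ S))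
      open ≡-Reasoning
      ℓ : Edge
      ℓ = lastE G b bs
      X≡′ : X ≡ z ++ frontWord (b ∷ bs ++ S) ++ Q′
      X≡′ = begin
        X                                  ≡⟨ X≡ ⟩
        P′ ++ frontWord S ++ Q′            ≡⟨ cong (_++ frontWord S ++ Q′) P′≡ ⟩
        (z ++ Bw ℓ) ++ frontWord S ++ Q′   ≡⟨ ++-assoc z _ _ ⟩
        z ++ Bw ℓ ++ frontWord S ++ Q′     ≡⟨ cong (z ++_) (sym (++-assoc (Bw ℓ) (frontWord S) Q′)) ⟩
        z ++ (Bw ℓ ++ frontWord S) ++ Q′   ≡⟨ cong (λ l → z ++ l ++ Q′) (sym F′) ⟩
        z ++ frontWord (b ∷ bs ++ S) ++ Q′ ∎

    X-framed : ∀ P Q → P ++ X ++ Q ≡ (P ++ P′) ++ frontWord S ++ Q′ ++ Q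
    X-framed P Q = begin
      P ++ X ++ Q                           ≡⟨ cong (λ l → P ++ l ++ Q) X≡ ⟩
      P ++ (P′ ++ frontWord S ++ Q′) ++ Q   ≡⟨ cong (P ++_) (++-assoc P′ _ Q) ⟩
      P ++ P′ ++ (frontWord S ++ Q′) ++ Q   ≡⟨ cong (λ l → P ++ P′ ++ l) (++-assoc (frontWord S) Q′ Q) ⟩
      P ++ P′ ++ frontWord S ++ Q′ ++ Q     ≡⟨ sym (++-assoc P P′ _) ⟩
      (P ++ P′) ++ frontWord S ++ Q′ ++ Q   ∎
      where open ≡-Reasoning

    placement : ∀ T → Walk T → SymmetricWalk T → ∀ P Q → frontWord T ≡ P ++ X ++ Q →
      Σ (List Edge) λ p → Σ (List Edge) λ q → T ≡ p ++ S ++ q × backs p ≡ P ++ P′ × fronts q ≡ Q′ ++ Q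
    placement T wT symT P Q FT≡
      with p , q , T≡ , i≡ ← Alignment.align s ss T wS symS wT symT
             (subst (λ l → OccAt (frontWord S) l (length (P ++ P′))) (sym (trans FT≡ (X-framed P Q)))
                    (occAt-++ (P ++ P′) (frontWord S) (Q′ ++ Q)))
      with backs≡ , rest≡ ← ++-split-≡ (backs p) _ (P ++ P′) _
             (trans (sym (frontWord-infix p s ss q T≡ wT (proj₁ symT) symS)) (trans FT≡ (X-framed P Q))) i≡
      = p , q , T≡ , backs≡ , ++-cancelˡ (frontWord S) _ _ rest≡

    upper-bound : ∀ T → Walk T → SymmetricWalk T → ∀ P Q → frontWord T ≡ P ++ X ++ Q →
                  length X ≤ length (frontWord S) + 2 * lmax G
    upper-bound T wT symT P Q FT≡ with p , q , T≡ , backs≡ , fronts≡ ← placement T wT symT P Q FT≡ = begin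
      length X                                        ≡⟨ cong length X≡ ⟩
      length (P′ ++ frontWord S ++ Q′)                ≡⟨ length-++-++ P′ (frontWord S) Q′ ⟩
      length P′ + (length (frontWord S) + length Q′)  ≤⟨ +-mono-≤ left (+-monoʳ-≤ (length (frontWord S)) right) ⟩
      lmax G + (length (frontWord S) + lmax G)        ≡⟨ rearrange (length (frontWord S)) (lmax G) ⟩
      length (frontWord S) + 2 * lmax G               ∎
      where
      open ≤-Reasoning
      rearrange : ∀ f l → l + (f + l) ≡ f + 2 * l
      rearrange = solve 2 (λ f l → l :+ (f :+ l) := f :+ con 2 :* l) refl
        where open +-*-Solver using (solve; _:+_; _:*_; _:=_; con)
      left : length P′ ≤ lmax G
      left = ≮⇒≥ (noRoomLeft p q (subst Walk T≡ wT) (subst StartsCollecting T≡ (proj₁ symT)) backs≡)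
      right : length Q′ ≤ lmax G
      right = ≮⇒≥ (noRoomRight p q (subst Walk T≡ wT) (subst EndsDistributing T≡ (proj₂ symT)) fronts≡)

lemma18 : {A : Set} (W : ℕ → A) → Recurrent W →
    (G : GraphWithWords A) → RauzyScheme G W →
    (X : List A) → FactorW X W →
    (s : Path G) → NonExtendable G X s →
    (length X ≤ length (Fp G s) + 2 * lmax G) × (length (Fp G s) ≤ length X)
lemma18 W _ G RS X X-factor (mkPath s ss wS) ((symS , P′ , Q′ , X≡) , maximal)
  with mkPath t ts wT , symT , P , Q , FT≡ ← RauzyScheme.covers RS X X-factor
  = Margins.upper-bound X s ss wS symS (λ x xs w sy F⊑X S⊑ → maximal (mkPath x xs w) (sy , F⊑X) S⊑) P′ Q′ X≡
                         (t ∷ ts) wT symT P Q FT≡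
  , ⊑⇒length≤ (P′ , Q′ , X≡)
  where open SchemeFacts G RS
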